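{- If $G$ is a connected graph and $x\in V(G)$ with $d_G(x)=2$, then $(G,h_x)$ is AT if and only if $G-x$ is degree-AT.
   Context: For an orientation $D$ of a graph, a spanning Eulerian subgraph is a spanning subgraph in which every vertex has indegree equal to outdegree; $EE(D)$ (resp. $EO(D)$) is the number of spanning Eulerian subgraphs with an even (resp. odd) number of edges. $D$ is AT if $EE(D)\ne EO(D)$. A graph $H$ is degree-AT if it has an AT orientation $D$ with $d_D^+(v)\le d_H(v)-1$ for every $v$. For $x\in V(G)$, $h_x(x)=1$ and $h_x(v)=0$ for $v\neq x$; $(G,h_x)$ is AT if $G$ has an AT orientation $D$ with $d_D^+(v)\le d_G(v)-h_x(v)-1$ for every vertex $v$. -}

module Defs where

open import Data.Nat using (ℕ; zero; suc; _+_; _≤_; _%_; _≡ᵇ_)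
open import Data.Bool using (Bool; true; false; _∧_; _∨_; if_then_else_)
open import Data.Fin using (Fin; punchOut; _≟_)
open import Data.Fin.Properties using () renaming (_≟_ to _≟F_)
open import Data.List using (List; []; _∷_; length; map; _++_; filterᵇ; allFin)
open import Data.Bool.ListAction using (and)
open import Data.List.Membership.Propositional using (_∈_)
open import Data.List.Relation.Unary.All using (All)
open import Data.List.Relation.Unary.AllPairs using (AllPairs)
open import Data.List.Relation.Binary.Pointwise using (Pointwise)
open import Data.Product using (_×_; _,_; proj₁; proj₂; ∃)
open import Data.Sum using (_⊎_)
open import Relation.Nullary using (¬_; yes; no)
open import Relation.Nullary.Decidable using (⌊_⌋)
open import Relation.Binary.PropositionalEquality using (_≡_; _≢_)

-- A graph on vertex set Fin n is given by its list of edges; an edge is a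
-- pair (u , v) read as the unordered pair {u , v}.
Edge : ℕ → Set
Edge n = Fin n × Fin n

SameEdge : ∀ {n} → Edge n → Edge n → Set
SameEdge (u , v) (u' , v') = ((u ≡ u') × (v ≡ v')) ⊎ ((u ≡ v') × (v ≡ u'))

Simple : ∀ {n} → List (Edge n) → Set
Simple E = All (λ e → proj₁ e ≢ proj₂ e) E × AllPairs (λ e f → ¬ SameEdge e f) E

data Reach {n} (E : List (Edge n)) : Fin n → Fin n → Set where
  here : ∀ {u} → Reach E u u
  fwd  : ∀ {u v w} → (u , v) ∈ E → Reach E v w → Reach E u w
  bwd  : ∀ {u v w} → (v , u) ∈ E → Reach E v w → Reach E u w

Connected : ∀ {n} → List (Edge n) → Set
Connected {n} E = (u v : Fin n) → Reach E u v

_==_ : ∀ {n} → Fin n → Fin n → Bool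
a == b = ⌊ a ≟F b ⌋

deg : ∀ {n} → List (Edge n) → Fin n → ℕ
deg E v = length (filterᵇ (λ e → (v == proj₁ e) ∨ (v == proj₂ e)) E)

IsOrientation : ∀ {n} → List (Edge n) → List (Edge n) → Set
IsOrientation E D =
  Pointwise (λ e a → (a ≡ e) ⊎ (a ≡ (proj₂ e , proj₁ e))) E D

outdeg : ∀ {n} → List (Edge n) → Fin n → ℕ
outdeg D v = length (filterᵇ (λ a → proj₁ a == v) D)

indeg : ∀ {n} → List (Edge n) → Fin n → ℕ
indeg D v = length (filterᵇ (λ a → proj₂ a == v) D)

-- all spanning subgraphs (= sub-collections of the arc list, by position)
subsets : ∀ {A : Set} → List A → List (List A)
subsets [] = [] ∷ []
subsets (a ∷ as) = map (a ∷_) (subsets as) ++ subsets as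

isEulerian : ∀ {n} → List (Edge n) → Bool
isEulerian {n} S = and (map (λ v → outdeg S v ≡ᵇ indeg S v) (allFin n))

isEven : ℕ → Bool
isEven k = (k % 2) ≡ᵇ 0

EE : ∀ {n} → List (Edge n) → ℕ
EE D = length (filterᵇ (λ S → isEulerian S ∧ isEven (length S)) (subsets D))

EO : ∀ {n} → List (Edge n) → ℕ
EO D = length (filterᵇ (λ S → isEulerian S ∧ (if isEven (length S) then false else true)) (subsets D))

AT : ∀ {n} → List (Edge n) → Set
AT D = ¬ (EE D ≡ EO D)

-- degree-AT: AT orientation with d⁺(v) ≤ d(v) - 1  (i.e. d⁺(v) + 1 ≤ d(v))
DegreeAT : ∀ {n} → List (Edge n) → Set
DegreeAT {n} E = ∃ λ D → IsOrientation E D × AT D × ((v : Fin n) → outdeg D v + 1 ≤ deg E v)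

h : ∀ {n} → Fin n → Fin n → ℕ
h x v = if x == v then 1 else 0

-- (G , h_x) is AT:  d⁺(v) ≤ d(v) - h_x(v) - 1
ATh : ∀ {n} → List (Edge n) → Fin n → Set
ATh {n} E x = ∃ λ D → IsOrientation E D × AT D × ((v : Fin n) → outdeg D v + h x v + 1 ≤ deg E v)

deleteVertex : ∀ {n} → Fin (suc n) → List (Edge (suc n)) → List (Edge n)
deleteVertex x [] = []
deleteVertex x ((u , v) ∷ E) with x ≟F u | x ≟F v
... | no p | no q = (punchOut p , punchOut q) ∷ deleteVertex x E
... | _    | _    = deleteVertex x E

-- Both sides speak about orientations in which x is a SINK:
--  * an orientation D witnessing (G , h_x) has d⁺(x) + 1 + 1 ≤ d(x) = 2,
--    so d⁺(x) = 0;
--  * conversely every orientation of G - x lifts to an orientation of G in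
--    which all edges at x point into x (this needs G to be loopless).
-- For an orientation D of G with sink x we show
--  (a) EE(D) = EE(D - x) and EO(D) = EO(D - x): an Eulerian subgraph cannot
--      use an arc into x (x would get positive indegree but outdegree 0), and
--      the Eulerian subgraphs avoiding x are exactly those of D - x, with the
--      same number of arcs;
--  (b) for y ≠ x, deleting x lowers d⁺_D(y) and d_G(y) by the same amount
--      (the number of edges yx, all oriented y → x), so the degree bounds
--      d⁺(y) + 1 ≤ d(y) in G and in G - x are equivalent.
module Submission where

open import Defs
open import Data.Nat using (ℕ; zero; suc; _+_; _≤_; _<_; _≡ᵇ_; s≤s; z≤n)
open import Data.Nat.Properties
  using (+-comm; +-assoc; +-identityʳ; +-cancelˡ-≤; +-monoʳ-≤; ≤-trans; m≤n+m;
         ≤-refl; <-irrefl; ≡ᵇ⇒≡; ≡⇒≡ᵇ; +-commutativeSemigroup;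
         module ≤-Reasoning)
open import Algebra.Properties.CommutativeSemigroup +-commutativeSemigroup using (interchange)
open import Data.Bool using (Bool; true; false; T; _∧_; _∨_; if_then_else_)
open import Data.Bool.Properties using (∨-comm; ∨-identityʳ)
open import Data.Fin using (Fin; punchOut; punchIn)
open import Data.Fin.Properties
  using (punchIn-punchOut; punchOut-punchIn; punchOut-cong; punchInᵢ≢i)
  renaming (_≟_ to _≟F_)
open import Data.List using (List; []; _∷_; [_]; length; map; _++_; filterᵇ; allFin)
open import Data.List.Properties using (length-++; filter-++)
open import Data.List.Membership.Propositional.Properties using (∈-allFin)
open import Data.List.Relation.Unary.All as All using (All; []; _∷_)
open import Data.List.Relation.Unary.All.Properties using (all⁺; all⁻)
open import Data.List.Relation.Unary.Any using (Any; here; there)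
open import Data.List.Relation.Binary.Pointwise using ([]; _∷_)
open import Data.Product using (Σ; _×_; _,_; proj₁; proj₂)
open import Data.Sum using (inj₁; inj₂)
open import Data.Empty using (⊥-elim)
open import Relation.Nullary using (yes; no; Dec; does)
open import Relation.Nullary.Decidable using (dec-true; dec-false; does-⇔; isYes≗does; T?)
open import Function using (_∘_)
open import Function.Bundles using (_⇔_; mk⇔; module Equivalence)
open import Function.Construct.Composition using (_⇔-∘_)
open import Function.Construct.Symmetry using (⇔-sym)
open import Relation.Binary.PropositionalEquality
  using (_≡_; _≢_; refl; sym; trans; cong; cong₂; subst; subst₂; module ≡-Reasoning)

bit : Bool → ℕ
bit true  = 1
bit false = 0

tally : ∀ {A : Set} → (A → Bool) → List A → ℕ
tally p L = length (filterᵇ p L)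

tally-∷ : ∀ {A : Set} (p : A → Bool) a L → tally p (a ∷ L) ≡ bit (p a) + tally p L
tally-∷ p a L with p a
... | true  = refl
... | false = refl

tally-none : ∀ {A : Set} (p : A → Bool) L → All (λ a → p a ≡ false) L → tally p L ≡ 0
tally-none p []      []          = refl
tally-none p (a ∷ L) (pa ∷ pL) = trans (tally-∷ p a L) (cong₂ _+_ (cong bit pa) (tally-none p L pL))

tally-none⁻ : ∀ {A : Set} (p : A → Bool) L → tally p L ≡ 0 → All (λ a → p a ≡ false) L
tally-none⁻ p []      _ = []
tally-none⁻ p (a ∷ L) none with p a in pa
... | false = pa ∷ tally-none⁻ p L none

tally-[] : ∀ {A : Set} (p : A → Bool) a → tally p [ a ] ≡ bit (p a)
tally-[] p a with p a
... | true  = refl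
... | false = refl

tally-++ : ∀ {A : Set} (p : A → Bool) xs ys → tally p (xs ++ ys) ≡ tally p xs + tally p ys
tally-++ p xs ys = trans (cong length (filter-++ (T? ∘ p) xs ys)) (length-++ (filterᵇ p xs))

tally-map : ∀ {A B : Set} (p : B → Bool) (g : A → B) xs → tally p (map g xs) ≡ tally (p ∘ g) xs
tally-map p g []       = refl
tally-map p g (a ∷ xs) =
  trans (tally-∷ p (g a) (map g xs))
        (trans (cong (bit (p (g a)) +_) (tally-map p g xs)) (sym (tally-∷ (p ∘ g) a xs)))

count : ∀ {A : Set} → (List A → Bool) → List A → ℕ
count f L = tally f (subsets L)

count-∷ : ∀ {A : Set} (f : List A → Bool) a L → count f (a ∷ L) ≡ count (f ∘ (a ∷_)) L + count f L
count-∷ f a L = trans (tally-++ f (map (a ∷_) (subsets L)) (subsets L))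
                      (cong (_+ count f L) (tally-map f (a ∷_) (subsets L)))

count-none : ∀ {A : Set} {P : A → Set} (f : List A → Bool) L →
             (∀ S → All P S → f S ≡ false) → All P L → count f L ≡ 0
count-none f []      none []         rewrite none [] [] = refl
count-none f (a ∷ L) none (pa ∷ pL) = trans (count-∷ f a L)
  (cong₂ _+_ (count-none (f ∘ (a ∷_)) L (λ S pS → none (a ∷ S) (pa ∷ pS)) pL) (count-none f L none pL))

T-⇔⇒≡ : ∀ {b c : Bool} → T b ⇔ T c → b ≡ c
T-⇔⇒≡ {b} {c} iff = does-⇔ iff (T? b) (T? c)

==-does : ∀ {m} (a b : Fin m) → (a == b) ≡ does (a ≟F b)
==-does a b = isYes≗does (a ≟F b)

==-refl : ∀ {m} (a : Fin m) → (a == a) ≡ true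
==-refl a = trans (==-does a a) (dec-true (a ≟F a) refl)

==-false : ∀ {m} {a b : Fin m} → a ≢ b → (a == b) ≡ false
==-false {a = a} {b} ne = trans (==-does a b) (dec-false (a ≟F b) ne)

==-false⁻ : ∀ {m} {a b : Fin m} → (a == b) ≡ false → a ≢ b
==-false⁻ {a = a} never refl with trans (sym (==-refl a)) never
... | ()

==-⇔ : ∀ {m k} {a b : Fin m} {c d : Fin k} → (a ≡ b) ⇔ (c ≡ d) → (a == b) ≡ (c == d)
==-⇔ {a = a} {b} {c} {d} iff =
  trans (==-does a b) (trans (does-⇔ iff (a ≟F b) (c ≟F d)) (sym (==-does c d)))

==-sym : ∀ {m} (a b : Fin m) → (a == b) ≡ (b == a)
==-sym a b = ==-⇔ (mk⇔ sym sym)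

Balanced : ∀ {m} → List (Edge m) → Set
Balanced {m} S = (v : Fin m) → outdeg S v ≡ indeg S v

eulerian⇔balanced : ∀ {m} (S : List (Edge m)) → T (isEulerian S) ⇔ Balanced S
eulerian⇔balanced {m} S = mk⇔
  (λ e v → ≡ᵇ⇒≡ _ _ (All.lookup (all⁺ balancedAt (allFin m) e) (∈-allFin v)))
  (λ b → all⁻ balancedAt {allFin m} (All.tabulate (λ {v} _ → ≡⇒≡ᵇ (outdeg S v) (indeg S v) (b v))))
  where
  balancedAt : Fin m → Bool
  balancedAt v = outdeg S v ≡ᵇ indeg S v

leaves : ∀ {m} → Fin m → Edge m → Bool
leaves v a = proj₁ a == v

incident : ∀ {m} → Fin m → Edge m → Bool
incident v e = (v == proj₁ e) ∨ (v == proj₂ e)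

deg-orientation : ∀ {m} {E D : List (Edge m)} → IsOrientation E D → ∀ v → deg E v ≡ deg D v
deg-orientation []                            v = refl
deg-orientation {E = (a , b) ∷ E} {D = _ ∷ D} (inj₁ refl ∷ rs) v =
  trans (tally-∷ (incident v) (a , b) E)
        (trans (cong (bit (incident v (a , b)) +_) (deg-orientation rs v)) (sym (tally-∷ (incident v) (a , b) D)))
deg-orientation {E = (a , b) ∷ E} {D = _ ∷ D} (inj₂ refl ∷ rs) v =
  trans (tally-∷ (incident v) (a , b) E)
        (trans (cong₂ _+_ (cong bit (∨-comm (v == a) (v == b))) (deg-orientation rs v))
               (sym (tally-∷ (incident v) (b , a) D)))

outdeg-forced-zero : ∀ k → k + 1 + 1 ≤ 2 → k ≡ 0
outdeg-forced-zero zero    _               = refl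
outdeg-forced-zero (suc k) (s≤s le) rewrite +-assoc k 1 1 | +-comm k 2 with le
... | s≤s ()

bound-transfer : ∀ o o' a b → o + 1 ≤ b → o + a ≡ o' + b → o' + 1 ≤ a
bound-transfer o o' a b le eq = +-cancelˡ-≤ o (o' + 1) a (begin
  o + (o' + 1)  ≡⟨ trans (sym (+-assoc o o' 1)) (trans (cong (_+ 1) (+-comm o o')) (+-assoc o' o 1)) ⟩
  o' + (o + 1)  ≤⟨ +-monoʳ-≤ o' le ⟩
  o' + b        ≡⟨ sym eq ⟩
  o + a         ∎)
  where open ≤-Reasoning

module Deletion {n : ℕ} (x : Fin (suc n)) where

  del : List (Edge (suc n)) → List (Edge n)
  del = deleteVertex x

  vertex-cases : {P : Fin (suc n) → Set} → P x → (∀ w → P (punchIn x w)) → ∀ v → P v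
  vertex-cases {P} px pw v with x ≟F v
  ... | yes refl = px
  ... | no x≢v   = subst P (punchIn-punchOut x≢v) (pw (punchOut x≢v))

  IsSink : List (Edge (suc n)) → Set
  IsSink D = All (λ a → x ≢ proj₁ a) D

  Enters : List (Edge (suc n)) → Set
  Enters S = Any (λ a → x ≡ proj₂ a) S

  Avoids : List (Edge (suc n)) → Set
  Avoids S = All (λ a → (x ≢ proj₁ a) × (x ≢ proj₂ a)) S

  del-keep : ∀ {u v} S (p : x ≢ u) (q : x ≢ v) → del ((u , v) ∷ S) ≡ (punchOut p , punchOut q) ∷ del S
  del-keep {u} {v} S p q with x ≟F u | x ≟F v
  ... | yes e  | _      = ⊥-elim (p e)
  ... | no _   | yes e  = ⊥-elim (q e)
  ... | no _   | no _   = cong₂ (λ a b → (a , b) ∷ del S) (punchOut-cong x refl) (punchOut-cong x refl)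

  del-head : ∀ {u v} S → x ≡ v → del ((u , v) ∷ S) ≡ del S
  del-head {u} {v} S e with x ≟F u | x ≟F v
  ... | yes _ | _     = refl
  ... | no _  | yes _ = refl
  ... | no _  | no q  = ⊥-elim (q e)

  del-tail : ∀ {u v} S → x ≡ u → del ((u , v) ∷ S) ≡ del S
  del-tail {u} {v} S e with x ≟F u
  ... | yes _ = refl
  ... | no p  = ⊥-elim (p e)

  del-++ : ∀ S T → del (S ++ T) ≡ del S ++ del T
  del-++ []            T = refl
  del-++ ((u , v) ∷ S) T with x ≟F u | x ≟F v
  ... | yes _ | _     = del-++ S T
  ... | no _  | yes _ = del-++ S T
  ... | no _  | no _  = cong (_ ∷_) (del-++ S T)

  del-orientation : ∀ {E D} → IsOrientation E D → IsOrientation (del E) (del D)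
  del-orientation [] = []
  del-orientation {(u , v) ∷ E} {_ ∷ D} (inj₁ refl ∷ rs) with x ≟F u | x ≟F v
  ... | yes _ | _     = del-orientation rs
  ... | no _  | yes _ = del-orientation rs
  ... | no _  | no _  = inj₁ refl ∷ del-orientation rs
  del-orientation {(u , v) ∷ E} {_ ∷ D} (inj₂ refl ∷ rs) with x ≟F u | x ≟F v
  ... | yes _ | yes _ = del-orientation rs
  ... | yes _ | no _  = del-orientation rs
  ... | no _  | yes _ = del-orientation rs
  ... | no _  | no _  = inj₂ refl ∷ del-orientation rs

  punchOut≡⇔ : ∀ {u} (p : x ≢ u) w → (punchOut p ≡ w) ⇔ (u ≡ punchIn x w)
  punchOut≡⇔ p w = mk⇔ (λ e → trans (sym (punchIn-punchOut p)) (cong (punchIn x) e))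
                       (λ e → trans (punchOut-cong x e) (punchOut-punchIn x))

  ==-punchOut : ∀ {u} (p : x ≢ u) w → (punchOut p == w) ≡ (u == punchIn x w)
  ==-punchOut p w = ==-⇔ (punchOut≡⇔ p w)

  ==-punchOut' : ∀ {u} (p : x ≢ u) w → (w == punchOut p) ≡ (punchIn x w == u)
  ==-punchOut' p w = ==-⇔ (mk⇔ (sym ∘ to ∘ sym) (sym ∘ from ∘ sym))
    where open Equivalence (punchOut≡⇔ p w)

  -- on lists avoiding x, deletion only renames vertices, so every statistic
  -- that is invariant under the renaming is preserved
  tally-avoid : (q : Edge (suc n) → Bool) (q' : Edge n → Bool) →
                (∀ {u v} (p : x ≢ u) (r : x ≢ v) → q (u , v) ≡ q' (punchOut p , punchOut r)) →
                ∀ S → Avoids S → tally q S ≡ tally q' (del S)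
  tally-avoid q q' inv []            []             = refl
  tally-avoid q q' inv ((u , v) ∷ S) ((p , r) ∷ aS) rewrite del-keep S p r =
    trans (tally-∷ q (u , v) S)
          (trans (cong₂ _+_ (cong bit (inv p r)) (tally-avoid q q' inv S aS))
                 (sym (tally-∷ q' _ (del S))))

  outdeg-avoid : ∀ S → Avoids S → ∀ w → outdeg S (punchIn x w) ≡ outdeg (del S) w
  outdeg-avoid S aS w = tally-avoid _ _ (λ p _ → sym (==-punchOut p w)) S aS

  indeg-avoid : ∀ S → Avoids S → ∀ w → indeg S (punchIn x w) ≡ indeg (del S) w
  indeg-avoid S aS w = tally-avoid _ _ (λ _ r → sym (==-punchOut r w)) S aS

  deg-avoid : ∀ S → Avoids S → ∀ w → deg S (punchIn x w) ≡ deg (del S) w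
  deg-avoid S aS w = tally-avoid _ _ (λ p r → sym (cong₂ _∨_ (==-punchOut' p w) (==-punchOut' r w))) S aS

  length-avoid : ∀ S → Avoids S → length (del S) ≡ length S
  length-avoid []            []             = refl
  length-avoid ((u , v) ∷ S) ((p , r) ∷ aS) rewrite del-keep S p r = cong suc (length-avoid S aS)

  outdeg-sink : ∀ S → IsSink S → outdeg S x ≡ 0
  outdeg-sink S sink = tally-none _ S (All.map (λ p → ==-false (p ∘ sym)) sink)

  indeg-avoided : ∀ S → Avoids S → indeg S x ≡ 0
  indeg-avoided S aS = tally-none _ S (All.map (λ (_ , r) → ==-false (r ∘ sym)) aS)

  indeg-positive : ∀ S → Enters S → 0 < indeg S x
  indeg-positive ((u , v) ∷ S) (here refl) rewrite tally-∷ (λ a → proj₂ a == x) (u , v) S | ==-refl x = s≤s z≤n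
  indeg-positive ((u , v) ∷ S) (there an) rewrite tally-∷ (λ a → proj₂ a == x) (u , v) S =
    ≤-trans (indeg-positive S an) (m≤n+m _ _)

  sink-hit-not-eulerian : ∀ S → IsSink S → Enters S → isEulerian S ≡ false
  sink-hit-not-eulerian S sink hit = T-⇔⇒≡ (mk⇔ contra λ ())
    where
    contra : T (isEulerian S) → T false
    contra e = ⊥-elim (<-irrefl (trans (sym (outdeg-sink S sink)) (Equivalence.to (eulerian⇔balanced S) e x))
                                (indeg-positive S hit))

  balanced-avoid : ∀ S → Avoids S → Balanced S ⇔ Balanced (del S)
  balanced-avoid S aS = mk⇔ restrict extend
    where
    restrict : Balanced S → Balanced (del S)
    restrict b w = trans (sym (outdeg-avoid S aS w)) (trans (b (punchIn x w)) (indeg-avoid S aS w))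
    extend : Balanced (del S) → Balanced S
    extend b = vertex-cases (trans (outdeg-sink S (All.map proj₁ aS)) (sym (indeg-avoided S aS)))
                            (λ w → trans (outdeg-avoid S aS w) (trans (b w) (sym (indeg-avoid S aS w))))

  eulerian-avoid : ∀ S → Avoids S → isEulerian S ≡ isEulerian (del S)
  eulerian-avoid S aS = T-⇔⇒≡
    (⇔-sym (eulerian⇔balanced (del S)) ⇔-∘ (balanced-avoid S aS ⇔-∘ eulerian⇔balanced S))

  -- (a) Subgraph counts are preserved by deleting a sink.  A sub-collection
  -- S of D either contains an arc into x, and then f rejects it, or avoids x,
  -- and then f agrees with f' on del S.
  count-sink : (f : List (Edge (suc n)) → Bool) (f' : List (Edge n) → Bool) → ∀ D → IsSink D →
               (∀ S → IsSink S → Enters S → f S ≡ false) →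
               (∀ S → Avoids S → f S ≡ f' (del S)) →
               count f D ≡ count f' (del D)
  count-sink f f' [] [] rejects agrees =
    trans (tally-∷ f [] []) (trans (cong (λ b → bit b + 0) (agrees [] [])) (sym (tally-∷ f' [] [])))
  count-sink f f' ((u , v) ∷ D) (x≢u ∷ sink) rejects agrees = by-head (x ≟F v)
    where
    open ≡-Reasoning
    rest : count f D ≡ count f' (del D)
    rest = count-sink f f' D sink rejects agrees
    by-head : Dec (x ≡ v) → count f ((u , v) ∷ D) ≡ count f' (del ((u , v) ∷ D))
    by-head (yes x≡v) = begin
      count f ((u , v) ∷ D)                   ≡⟨ count-∷ f (u , v) D ⟩
      count (f ∘ ((u , v) ∷_)) D + count f D  ≡⟨ cong₂ _+_ (count-none _ D (λ S sS → rejects _ (x≢u ∷ sS) (here x≡v)) sink) rest ⟩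
      count f' (del D)                        ≡⟨ cong (count f') (sym (del-head D x≡v)) ⟩
      count f' (del ((u , v) ∷ D))            ∎
    by-head (no x≢v) = begin
      count f ((u , v) ∷ D)                            ≡⟨ count-∷ f (u , v) D ⟩
      count (f ∘ ((u , v) ∷_)) D + count f D           ≡⟨ cong (_+ count f D) with-arc ⟩
      count (f' ∘ (a' ∷_)) (del D) + count f D         ≡⟨ cong (count (f' ∘ (a' ∷_)) (del D) +_) rest ⟩
      count (f' ∘ (a' ∷_)) (del D) + count f' (del D)  ≡⟨ sym (count-∷ f' a' (del D)) ⟩
      count f' (a' ∷ del D)                            ≡⟨ cong (count f') (sym (del-keep D x≢u x≢v)) ⟩
      count f' (del ((u , v) ∷ D))                     ∎
      where
      a' : Edge n
      a' = punchOut x≢u , punchOut x≢v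
      with-arc : count (f ∘ ((u , v) ∷_)) D ≡ count (f' ∘ (a' ∷_)) (del D)
      with-arc = count-sink _ _ D sink
        (λ S sS hit → rejects _ (x≢u ∷ sS) (there hit))
        (λ S aS → trans (agrees _ ((x≢u , x≢v) ∷ aS)) (cong f' (del-keep S x≢u x≢v)))

  isOdd : ℕ → Bool
  isOdd k = if isEven k then false else true

  EE-sink : ∀ D → IsSink D → EE D ≡ EE (del D)
  EE-sink D sink = count-sink _ _ D sink
    (λ S sS hit → cong (_∧ isEven (length S)) (sink-hit-not-eulerian S sS hit))
    (λ S aS → cong₂ _∧_ (eulerian-avoid S aS) (cong isEven (sym (length-avoid S aS))))

  EO-sink : ∀ D → IsSink D → EO D ≡ EO (del D)
  EO-sink D sink = count-sink _ _ D sink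
    (λ S sS hit → cong (_∧ isOdd (length S)) (sink-hit-not-eulerian S sS hit))
    (λ S aS → cong₂ _∧_ (eulerian-avoid S aS) (cong isOdd (sym (length-avoid S aS))))

  AT-sink : ∀ {D} → IsSink D → AT D ⇔ AT (del D)
  AT-sink {D} sink = mk⇔ (λ at eq → at (trans (EE-sink D sink) (trans eq (sym (EO-sink D sink)))))
                         (λ at eq → at (trans (sym (EE-sink D sink)) (trans eq (EO-sink D sink))))

  sink-degree-arc : ∀ {u v} → x ≢ u → ∀ w →
    outdeg [ (u , v) ] (punchIn x w) + deg (del [ (u , v) ]) w ≡ outdeg (del [ (u , v) ]) w + deg [ (u , v) ] (punchIn x w)
  sink-degree-arc {u} {v} x≢u w = by-head (x ≟F v)
    where
    y : Fin (suc n)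
    y = punchIn x w
    by-head : Dec (x ≡ v) →
      outdeg [ (u , v) ] y + deg (del [ (u , v) ]) w ≡ outdeg (del [ (u , v) ]) w + deg [ (u , v) ] y
    by-head (no x≢v) = cong₂ _+_ (outdeg-avoid [ (u , v) ] ((x≢u , x≢v) ∷ []) w)
                                 (sym (deg-avoid [ (u , v) ] ((x≢u , x≢v) ∷ []) w))
    -- the arc y → x disappears, counted once in d⁺(y) and once in d(y)
    by-head (yes x≡v) = begin
      outdeg [ (u , v) ] y + deg (del [ (u , v) ]) w  ≡⟨ cong (λ L → outdeg [ (u , v) ] y + deg L w) (del-head [] x≡v) ⟩
      outdeg [ (u , v) ] y + 0                        ≡⟨ +-identityʳ _ ⟩
      outdeg [ (u , v) ] y                            ≡⟨ tally-[] (leaves y) (u , v) ⟩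
      bit (u == y)                                    ≡⟨ cong bit tail≡incident ⟩
      bit (incident y (u , v))                        ≡⟨ sym (tally-[] (incident y) (u , v)) ⟩
      deg [ (u , v) ] y                               ≡⟨ cong (λ L → outdeg L w + deg [ (u , v) ] y) (sym (del-head [] x≡v)) ⟩
      outdeg (del [ (u , v) ]) w + deg [ (u , v) ] y  ∎
      where
      open ≡-Reasoning
      y≢v : (y == v) ≡ false
      y≢v = ==-false (λ y≡v → punchInᵢ≢i x w (trans y≡v (sym x≡v)))
      tail≡incident : (u == y) ≡ incident y (u , v)
      tail≡incident = trans (==-sym u y) (sym (trans (cong ((y == u) ∨_) y≢v) (∨-identityʳ _)))

  sink-degree : ∀ D → IsSink D → ∀ w →
    outdeg D (punchIn x w) + deg (del D) w ≡ outdeg (del D) w + deg D (punchIn x w)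
  sink-degree []      []         w = refl
  sink-degree (a ∷ D) (x≢a ∷ sink) w = begin
    outdeg (a ∷ D) y + deg (del (a ∷ D)) w
      ≡⟨ cong₂ _+_ (tally-++ (leaves y) [ a ] D) (split (incident w)) ⟩
    (outdeg [ a ] y + outdeg D y) + (deg (del [ a ]) w + deg (del D) w)
      ≡⟨ interchange (outdeg [ a ] y) (outdeg D y) (deg (del [ a ]) w) (deg (del D) w) ⟩
    (outdeg [ a ] y + deg (del [ a ]) w) + (outdeg D y + deg (del D) w)
      ≡⟨ cong₂ _+_ (sink-degree-arc x≢a w) (sink-degree D sink w) ⟩
    (outdeg (del [ a ]) w + deg [ a ] y) + (outdeg (del D) w + deg D y)
      ≡⟨ interchange (outdeg (del [ a ]) w) (deg [ a ] y) (outdeg (del D) w) (deg D y) ⟩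
    (outdeg (del [ a ]) w + outdeg (del D) w) + (deg [ a ] y + deg D y)
      ≡⟨ sym (cong₂ _+_ (split (leaves w)) (tally-++ (incident y) [ a ] D)) ⟩
    outdeg (del (a ∷ D)) w + deg (a ∷ D) y
      ∎
    where
    open ≡-Reasoning
    y : Fin (suc n)
    y = punchIn x w
    split : ∀ p → tally p (del (a ∷ D)) ≡ tally p (del [ a ]) + tally p (del D)
    split p = trans (cong (tally p) (del-++ [ a ] D)) (tally-++ p (del [ a ]) (del D))

  -- (b) the same for an orientation D of E, as degrees do not see orientations
  degree-transfer : ∀ {E D} → IsOrientation E D → IsSink D → ∀ w →
    outdeg D (punchIn x w) + deg (del E) w ≡ outdeg (del D) w + deg E (punchIn x w)
  degree-transfer {D = D} o sink w
    rewrite deg-orientation o (punchIn x w) | deg-orientation (del-orientation o) w = sink-degree D sink w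

  bound-sink : ∀ {E D} → IsOrientation E D → IsSink D → ∀ w →
    (outdeg D (punchIn x w) + 1 ≤ deg E (punchIn x w)) ⇔ (outdeg (del D) w + 1 ≤ deg (del E) w)
  bound-sink o sink w = mk⇔ (λ le → bound-transfer _ _ _ _ le (degree-transfer o sink w))
                            (λ le → bound-transfer _ _ _ _ le (sym (degree-transfer o sink w)))

  sink-of-outdeg-zero : ∀ D → outdeg D x ≡ 0 → IsSink D
  sink-of-outdeg-zero D none = All.map (λ never x≡u → ==-false⁻ never (sym x≡u)) (tally-none⁻ (leaves x) D none)

  -- every orientation of E - x lifts to an orientation of E with sink x:
  -- edges at x are oriented into x (E loopless), the others as in D'
  Lift : List (Edge (suc n)) → List (Edge n) → Set
  Lift E D' = Σ (List (Edge (suc n))) λ D → IsOrientation E D × IsSink D × del D ≡ D'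

  lift : ∀ E D' → All (λ e → proj₁ e ≢ proj₂ e) E → IsOrientation (del E) D' → Lift E D'
  lift []            []  []          []  = [] , [] , [] , refl
  lift ((u , v) ∷ E) D' (u≢v ∷ loopless) o = by-ends (x ≟F u) (x ≟F v)
    where
    by-ends : Dec (x ≡ u) → Dec (x ≡ v) → Lift ((u , v) ∷ E) D'
    by-ends (yes x≡u) _ with lift E D' loopless (subst (λ L → IsOrientation L D') (del-tail E x≡u) o)
    ... | D , oD , sink , refl = (v , u) ∷ D , inj₂ refl ∷ oD , (λ x≡v → u≢v (trans (sym x≡u) x≡v)) ∷ sink
                               , del-head D x≡u
    by-ends (no x≢u) (yes x≡v) with lift E D' loopless (subst (λ L → IsOrientation L D') (del-head E x≡v) o)
    ... | D , oD , sink , refl = (u , v) ∷ D , inj₁ refl ∷ oD , x≢u ∷ sink , del-head D x≡v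
    by-ends (no x≢u) (no x≢v) = follow D' (subst (λ L → IsOrientation L D') (del-keep E x≢u x≢v) o)
      where
      follow : ∀ D' → IsOrientation ((punchOut x≢u , punchOut x≢v) ∷ del E) D' → Lift ((u , v) ∷ E) D'
      follow (_ ∷ D'') (inj₁ refl ∷ rs) with lift E D'' loopless rs
      ... | D , oD , sink , refl = (u , v) ∷ D , inj₁ refl ∷ oD , x≢u ∷ sink , del-keep D x≢u x≢v
      follow (_ ∷ D'') (inj₂ refl ∷ rs) with lift E D'' loopless rs
      ... | D , oD , sink , refl = (v , u) ∷ D , inj₂ refl ∷ oD , x≢v ∷ sink , del-keep D x≢v x≢u

lemma6 : ∀ {n} (E : List (Edge (suc n))) → Simple E → Connected E →
         (x : Fin (suc n)) → deg E x ≡ 2 →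
         (ATh E x ⇔ DegreeAT (deleteVertex x E))
lemma6 {n} E (loopless , _) _ x dx = mk⇔ restrict extend
  where
  open Deletion x

  h-at-x : h x x ≡ 1
  h-at-x = cong (λ b → if b then 1 else 0) (==-refl x)

  h-away : ∀ {o} w → o + h x (punchIn x w) ≡ o
  h-away {o} w = trans (cong (λ b → o + (if b then 1 else 0)) (==-false (punchInᵢ≢i x w ∘ sym))) (+-identityʳ o)

  restrict : ATh E x → DegreeAT (del E)
  restrict (D , o , at , bound) =
    del D , del-orientation o , Equivalence.to (AT-sink sink) at ,
    λ w → Equivalence.to (bound-sink o sink w) (subst (λ t → t + 1 ≤ deg E (punchIn x w)) (h-away w) (bound (punchIn x w)))
    where
    -- d⁺(x) + 1 + 1 ≤ d(x) = 2 forces x to be a sink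
    sink : IsSink D
    sink = sink-of-outdeg-zero D (outdeg-forced-zero _ (subst₂ _≤_ (cong (λ t → outdeg D x + t + 1) h-at-x) dx (bound x)))

  extend : DegreeAT (del E) → ATh E x
  extend (D' , o' , at' , bound') with lift E D' loopless o'
  ... | D , o , sink , refl = D , o , Equivalence.from (AT-sink sink) at' , vertex-cases at-x away
    where
    Bound : Fin (suc n) → Set
    Bound y = outdeg D y + h x y + 1 ≤ deg E y
    at-x : Bound x
    at-x = subst₂ _≤_ (cong₂ (λ a b → a + b + 1) (sym (outdeg-sink D sink)) (sym h-at-x)) (sym dx) ≤-refl
    away : ∀ w → Bound (punchIn x w)
    away w = subst (λ t → t + 1 ≤ deg E (punchIn x w)) (sym (h-away w)) (Equivalence.from (bound-sink o sink w) (bound' w))
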